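{- Let $\alpha_0\subset\alpha$ satisfy $\alpha_0\cup\tau(\alpha_0)=\alpha$, and let $Y$ be an $\alpha_0$-quandle compatible with $\tau$. Then there is a unique $\alpha$-kei $X$ whose restriction to $\alpha_0$ is $Y$.
   Context: Let $\alpha$ be a set with an involution $\tau$. For a set $\gamma$, a $\gamma$-quandle is a non-empty set $X$ together with, for each $a\in\gamma$, a bijection $x\mapsto ax$ of $X$ and a binary operation $(x,y)\mapsto x*_ay$ on $X$, such that for all $a\in\gamma$, $x,y,z\in X$: (i) $ax*_ax=x$; (ii) $a(x*_ay)=ax*_aay$; (iii) $(x*_ay)*_az=(x*_aaz)*_a(y*_az)$; (iv) $x\mapsto x*_az$ is a bijection of $X$. An $\alpha$-kei is an $\alpha$-quandle such that moreover (v) $a\tau(a)x=x$ and (vi) $(x*_ay)*_{\tau(a)}ay=x$ for all $x,y\in X$, $a\in\alpha$. The restriction of an $\alpha$-kei (or $\alpha$-quandle) $X$ to $\alpha_0\subset\alpha$ is the same set with only the operations indexed by $a\in\alpha_0$; it is an $\alpha_0$-quandle. An $\alpha_0$-quandle $Y$ is compatible with $\tau$ if $a\tau(a)x=x$ and $(x*_ay)*_{\tau(a)}ay=x$ for all $a\in\alpha_0\cap\tau(\alpha_0)$ and $x,y\in Y$. -}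

module Defs where

open import Data.Product using (Σ; ∃; _×_; _,_; proj₁)
open import Relation.Binary.PropositionalEquality using (_≡_)
open import Relation.Unary using (Pred)
open import Function.Definitions using (Bijective)
open import Level using (0ℓ)

IsBijection : {X : Set} → (X → X) → Set
IsBijection = Bijective _≡_ _≡_

-- A γ-quandle structure on a carrier X, for an index set γ.
-- act a x  is  "a x";   op a x y  is  "x *_a y".
record Quandle (γ : Set) (X : Set) : Set where
  field
    nonempty : X
    act      : γ → X → X
    op       : γ → X → X → X
    act-bij  : ∀ a → IsBijection (act a)
    law-i    : ∀ a x → op a (act a x) x ≡ x
    law-ii   : ∀ a x y → act a (op a x y) ≡ op a (act a x) (act a y)
    law-iii  : ∀ a x y z → op a (op a x y) z ≡ op a (op a x (act a z)) (op a y z)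
    law-iv   : ∀ a z → IsBijection (λ x → op a x z)

record Kei (α : Set) (τ : α → α) (X : Set) : Set where
  field
    quandle : Quandle α X
  open Quandle quandle public
  field
    law-v  : ∀ a x → act a (act (τ a) x) ≡ x
    law-vi : ∀ a x y → op (τ a) (op a x y) (act a y) ≡ x

-- A subset α₀ ⊆ α is a proof-irrelevant predicate; α₀-quandles are
-- quandles indexed by the elements of α₀, i.e. by Σ α α₀.
SubQuandle : {α : Set} → Pred α 0ℓ → Set → Set
SubQuandle {α} α₀ X = Quandle (Σ α α₀) X

Image : {α : Set} → (α → α) → Pred α 0ℓ → Pred α 0ℓ
Image τ α₀ a = ∃ λ b → α₀ b × τ b ≡ a

-- Compatibility of an α₀-quandle with τ: for a ∈ α₀ ∩ τ(α₀)
-- (so that τ(a) ∈ α₀, witnessed by q).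
Compatible : {α : Set} (τ : α → α) (α₀ : Pred α 0ℓ) {Y : Set} →
             SubQuandle α₀ Y → Set
Compatible {α} τ α₀ {Y} Q =
  ∀ (a : α) (p : α₀ a) (q : α₀ (τ a)) (x y : Y) →
    (act (a , p) (act (τ a , q) x) ≡ x) ×
    (op (τ a , q) (op (a , p) x y) (act (a , p) y) ≡ x)
  where open Quandle Q

RestrictsTo : {α : Set} {τ : α → α} {α₀ : Pred α 0ℓ} {Y : Set} →
              Kei α τ Y → SubQuandle α₀ Y → Set
RestrictsTo {α} {τ} {α₀} {Y} K Q =
  (∀ (a : α) (p : α₀ a) (x : Y) → Kei.act K a x ≡ Quandle.act Q (a , p) x) ×
  (∀ (a : α) (p : α₀ a) (x y : Y) → Kei.op K a x y ≡ Quandle.op Q (a , p) x y)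

SameKei : {α : Set} {τ : α → α} {Y : Set} → Kei α τ Y → Kei α τ Y → Set
SameKei {α} {τ} {Y} K K' =
  (∀ (a : α) (x : Y) → Kei.act K a x ≡ Kei.act K' a x) ×
  (∀ (a : α) (x y : Y) → Kei.op K a x y ≡ Kei.op K' a x y)

-- Axioms (v) and (vi) say that the structure of a kei at τ(a) is determined by
-- the one at a: it is its dual, with action a⁻¹ and x ⋆ z = (− *_a a⁻¹z)⁻¹ x.
-- As α₀ ∪ τ(α₀) = α, a kei restricting to Y must therefore be Y_a at a ∈ α₀ and
-- the dual of Y_b at τ(b), b ∈ α₀. Compatibility of Y says precisely that these
-- prescriptions agree on α₀ ∩ τ(α₀), and since the dual of the dual pairs back
-- with the original structure, the structure so defined satisfies (v) and (vi).

module Submission where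

open import Defs
open import Data.Product using (Σ; _×_; _,_; proj₁; proj₂)
open import Data.Sum using (_⊎_; inj₁; inj₂)
open import Function.Bundles using (_↔_; mk⤖; Inverse; Bijection)
open import Function.Properties.Bijection using (⤖⇒↔)
open import Function.Properties.Inverse using (↔-sym; ↔⇒⤖)
open import Relation.Binary.PropositionalEquality
open import Relation.Unary using (Pred; Irrelevant)
open import Level using (0ℓ)

module Inverses {Y : Set} {f : Y → Y} (f-bij : IsBijection f) where

  private
    f↔ : Y ↔ Y
    f↔ = ⤖⇒↔ (mk⤖ f-bij)

  open Inverse f↔ public using ()
    renaming (from to f⁻¹; strictlyInverseˡ to f∘f⁻¹; strictlyInverseʳ to f⁻¹∘f)

  f⁻¹-bij : IsBijection f⁻¹
  f⁻¹-bij = Bijection.bijective (↔⇒⤖ (↔-sym f↔))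

record Quandle₁ (Y : Set) : Set where
  field
    act     : Y → Y
    op      : Y → Y → Y
    act-bij : IsBijection act
    law-i   : ∀ x → op (act x) x ≡ x
    law-ii  : ∀ x y → act (op x y) ≡ op (act x) (act y)
    law-iii : ∀ x y z → op (op x y) z ≡ op (op x (act z)) (op y z)
    law-iv  : ∀ z → IsBijection (λ x → op x z)

component : {γ Y : Set} → Quandle γ Y → γ → Quandle₁ Y
component Q a = record
  { act = act a ; op = op a ; act-bij = act-bij a ; law-i = law-i a
  ; law-ii = law-ii a ; law-iii = law-iii a ; law-iv = law-iv a }
  where open Quandle Q

fromComponents : {γ Y : Set} → (γ → Quandle₁ Y) → Y → Quandle γ Y
fromComponents S y = record
  { nonempty = y
  ; act = λ a → Quandle₁.act (S a) ; op = λ a → Quandle₁.op (S a)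
  ; act-bij = λ a → Quandle₁.act-bij (S a)
  ; law-i = λ a → Quandle₁.law-i (S a) ; law-ii = λ a → Quandle₁.law-ii (S a)
  ; law-iii = λ a → Quandle₁.law-iii (S a) ; law-iv = λ a → Quandle₁.law-iv (S a) }

module _ {Y : Set} where

  infix 4 _≅_

  record _≅_ (A B : Quandle₁ Y) : Set where
    constructor _,≅_
    field
      act-≡ : ∀ x → Quandle₁.act A x ≡ Quandle₁.act B x
      op-≡  : ∀ x y → Quandle₁.op A x y ≡ Quandle₁.op B x y

  open _≅_ public

  ≅-refl : {A : Quandle₁ Y} → A ≅ A
  ≅-refl = (λ _ → refl) ,≅ (λ _ _ → refl)

  ≡⇒≅ : {A B : Quandle₁ Y} → A ≡ B → A ≅ B
  ≡⇒≅ refl = ≅-refl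

  ≅-sym : {A B : Quandle₁ Y} → A ≅ B → B ≅ A
  ≅-sym (p ,≅ q) = (λ x → sym (p x)) ,≅ (λ x y → sym (q x y))

  ≅-trans : {A B C : Quandle₁ Y} → A ≅ B → B ≅ C → A ≅ C
  ≅-trans (p ,≅ q) (p′ ,≅ q′) =
    (λ x → trans (p x) (p′ x)) ,≅ (λ x y → trans (q x y) (q′ x y))

  record KeiPair (A B : Quandle₁ Y) : Set where
    constructor _,ᴷ_
    open Quandle₁
    field
      act-cancel : ∀ x → act A (act B x) ≡ x
      op-cancel  : ∀ x y → op B (op A x y) (act A y) ≡ x

  open KeiPair public

  KeiPair-resp-≅ : {A A′ B B′ : Quandle₁ Y} →
                   A ≅ A′ → B ≅ B′ → KeiPair A′ B′ → KeiPair A B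
  KeiPair-resp-≅ {A} {A′} {B} {B′} A≅A′ B≅B′ P =
    (λ x → begin
       Quandle₁.act A (Quandle₁.act B x)    ≡⟨ act-≡ A≅A′ _ ⟩
       Quandle₁.act A′ (Quandle₁.act B x)   ≡⟨ cong (Quandle₁.act A′) (act-≡ B≅B′ x) ⟩
       Quandle₁.act A′ (Quandle₁.act B′ x)  ≡⟨ act-cancel P x ⟩
       x                                    ∎) ,ᴷ
    (λ x y → begin
       Quandle₁.op B (Quandle₁.op A x y) (Quandle₁.act A y)
         ≡⟨ op-≡ B≅B′ _ _ ⟩
       Quandle₁.op B′ (Quandle₁.op A x y) (Quandle₁.act A y)
         ≡⟨ cong₂ (Quandle₁.op B′) (op-≡ A≅A′ x y) (act-≡ A≅A′ y) ⟩
       Quandle₁.op B′ (Quandle₁.op A′ x y) (Quandle₁.act A′ y)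
         ≡⟨ op-cancel P x y ⟩
       x ∎)
    where open ≡-Reasoning

  -- (vi) fixes *_B on every pair (u *_A v , a v), and these are all pairs
  -- because a and − *_A v are onto.
  KeiPair-unique : {A B B′ : Quandle₁ Y} → KeiPair A B → KeiPair A B′ → B ≅ B′
  KeiPair-unique {A} {B} {B′} P P′ = act-agrees ,≅ op-agrees
    where
    module A = Quandle₁ A
    module B = Quandle₁ B
    module B′ = Quandle₁ B′
    module a = Inverses A.act-bij
    open ≡-Reasoning

    act-agrees : ∀ x → B.act x ≡ B′.act x
    act-agrees x = proj₁ A.act-bij (trans (act-cancel P x) (sym (act-cancel P′ x)))

    op-agrees : ∀ x z → B.op x z ≡ B′.op x z
    op-agrees x z = begin
      B.op x z                    ≡⟨ cong₂ B.op (sym (R.f∘f⁻¹ x)) (sym (a.f∘f⁻¹ z)) ⟩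
      B.op (A.op u v) (A.act v)   ≡⟨ op-cancel P u v ⟩
      u                           ≡⟨ sym (op-cancel P′ u v) ⟩
      B′.op (A.op u v) (A.act v)  ≡⟨ cong₂ B′.op (R.f∘f⁻¹ x) (a.f∘f⁻¹ z) ⟩
      B′.op x z                   ∎
      where
      v : Y
      v = a.f⁻¹ z
      module R = Inverses (A.law-iv v)
      u : Y
      u = R.f⁻¹ x

module Dual {Y : Set} (A : Quandle₁ Y) where
  open Quandle₁ A
  open Inverses act-bij renaming (f⁻¹ to g; f∘f⁻¹ to act∘g; f⁻¹∘f to g∘act)
  module R z = Inverses (law-iv z)
  open ≡-Reasoning

  infixl 7 _⋆_
  _⋆_ : Y → Y → Y
  x ⋆ z = R.f⁻¹ (g z) x

  ⋆-spec : ∀ x z → op (x ⋆ z) (g z) ≡ x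
  ⋆-spec x z = R.f∘f⁻¹ (g z) x

  ⋆-char : ∀ {x z w} → op w (g z) ≡ x → x ⋆ z ≡ w
  ⋆-char {z = z} {w} refl = R.f⁻¹∘f (g z) w

  ⋆-law-i : ∀ x → g x ⋆ x ≡ x
  ⋆-law-i x = ⋆-char (begin
    op x (g x)           ≡⟨ cong (λ t → op t (g x)) (sym (act∘g x)) ⟩
    op (act (g x)) (g x) ≡⟨ law-i (g x) ⟩
    g x                  ∎)

  ⋆-law-ii : ∀ x y → g (x ⋆ y) ≡ g x ⋆ g y
  ⋆-law-ii x y = sym (⋆-char (proj₁ act-bij (begin
    act (op (g (x ⋆ y)) (g (g y)))       ≡⟨ law-ii _ _ ⟩
    op (act (g (x ⋆ y))) (act (g (g y))) ≡⟨ cong₂ op (act∘g _) (act∘g _) ⟩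
    op (x ⋆ y) (g y)                     ≡⟨ ⋆-spec x y ⟩
    x                                    ≡⟨ sym (act∘g x) ⟩
    act (g x)                            ∎)))

  ⋆-law-iii : ∀ x y z → (x ⋆ y) ⋆ z ≡ (x ⋆ g z) ⋆ (y ⋆ z)
  ⋆-law-iii x y z = ⋆-char (sym (⋆-char (begin
    op (op w (g z)) (g y)
      ≡⟨ cong₂ (λ s t → op (op w s) t) (sym (act∘g (g z))) (sym g-⋆-spec) ⟩
    op (op w (act (g (g z)))) (op (g (y ⋆ z)) (g (g z)))
      ≡⟨ sym (law-iii w (g (y ⋆ z)) (g (g z))) ⟩
    op (op w (g (y ⋆ z))) (g (g z))
      ≡⟨ cong (λ t → op t (g (g z))) (⋆-spec (x ⋆ g z) (y ⋆ z)) ⟩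
    op (x ⋆ g z) (g (g z))
      ≡⟨ ⋆-spec x (g z) ⟩
    x ∎)))
    where
    w : Y
    w = (x ⋆ g z) ⋆ (y ⋆ z)
    g-⋆-spec : op (g (y ⋆ z)) (g (g z)) ≡ g y
    g-⋆-spec = trans (cong (λ t → op t (g (g z))) (⋆-law-ii y z)) (⋆-spec (g y) (g z))

  dual : Quandle₁ Y
  dual = record
    { act = g ; op = _⋆_ ; act-bij = f⁻¹-bij ; law-i = ⋆-law-i ; law-ii = ⋆-law-ii
    ; law-iii = ⋆-law-iii ; law-iv = λ z → R.f⁻¹-bij (g z) }

  KeiPair-dualʳ : KeiPair A dual
  KeiPair-dualʳ = act∘g ,ᴷ λ x y → ⋆-char (cong (op x) (g∘act y))

  KeiPair-dualˡ : KeiPair dual A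
  KeiPair-dualˡ = g∘act ,ᴷ ⋆-spec

open Dual public using (dual; KeiPair-dualʳ; KeiPair-dualˡ)

component-KeiPair : {α Y : Set} {τ : α → α} (X : Kei α τ Y) → ∀ a →
  KeiPair (component (Kei.quandle X) a) (component (Kei.quandle X) (τ a))
component-KeiPair X a = Kei.law-v X a ,ᴷ Kei.law-vi X a

module Extension
    (α : Set) (τ : α → α) (τ-invol : ∀ a → τ (τ a) ≡ a)
    (α₀ : Pred α 0ℓ) (α₀-prop : Irrelevant α₀)
    (cover : ∀ a → α₀ a ⊎ Image τ α₀ a)
    {Y : Set} (QY : SubQuandle α₀ Y) (compatible : Compatible τ α₀ QY) where

  τ-injective : ∀ {a b} → τ a ≡ τ b → a ≡ b
  τ-injective {a} {b} e = trans (sym (τ-invol a)) (trans (cong τ e) (τ-invol b))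

  Yₐ : (a : α) → α₀ a → Quandle₁ Y
  Yₐ a p = component QY (a , p)

  Yₐ-cong : ∀ {a b} (p : α₀ a) (q : α₀ b) → a ≡ b → Yₐ a p ≡ Yₐ b q
  Yₐ-cong p q refl = cong (Yₐ _) (α₀-prop p q)

  Yₐ-τ : ∀ {b} (p : α₀ b) (q : α₀ (τ b)) → Yₐ (τ b) q ≅ dual (Yₐ b p)
  Yₐ-τ {b} p q = KeiPair-unique compatible-pair (KeiPair-dualʳ (Yₐ b p))
    where
    compatible-pair : KeiPair (Yₐ b p) (Yₐ (τ b) q)
    compatible-pair = (λ x → proj₁ (compatible b p q x x)) ,ᴷ
                      (λ x y → proj₂ (compatible b p q x y))

  -- The component an α-kei restricting to Y is forced to have at a.
  record Prescribed (a : α) (A : Quandle₁ Y) : Set where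
    field
      on-α₀    : (p : α₀ a) → A ≅ Yₐ a p
      on-image : ∀ b (p : α₀ b) → τ b ≡ a → A ≅ dual (Yₐ b p)

  open Prescribed

  on-α₀-at : ∀ {a b A} → Prescribed a A → (q : α₀ b) → a ≡ b → A ≅ Yₐ b q
  on-α₀-at P q refl = on-α₀ P q

  prescribed-unique : ∀ {a A B} → Prescribed a A → Prescribed a B → A ≅ B
  prescribed-unique {a} P Q with cover a
  ... | inj₁ p = ≅-trans (on-α₀ P p) (≅-sym (on-α₀ Q p))
  ... | inj₂ (b , p , e) = ≅-trans (on-image P b p e) (≅-sym (on-image Q b p e))

  prescribed-KeiPair : ∀ {a A B} → Prescribed a A → Prescribed (τ a) B → KeiPair A B
  prescribed-KeiPair {a} P Q with cover a
  ... | inj₁ p =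
    KeiPair-resp-≅ (on-α₀ P p) (on-image Q a p refl) (KeiPair-dualʳ (Yₐ a p))
  ... | inj₂ (b , p , refl) =
    KeiPair-resp-≅ (on-image P b p refl) (on-α₀-at Q p (τ-invol b)) (KeiPair-dualˡ (Yₐ b p))

  choose : (a : α) → α₀ a ⊎ Image τ α₀ a → Quandle₁ Y
  choose a (inj₁ p)           = Yₐ a p
  choose a (inj₂ (b , p , _)) = dual (Yₐ b p)

  choose-prescribed : ∀ a c → Prescribed a (choose a c)
  choose-prescribed a (inj₁ p) = record
    { on-α₀    = λ q → ≡⇒≅ (Yₐ-cong p q refl)
    ; on-image = λ { b q refl → Yₐ-τ q p } }
  choose-prescribed a (inj₂ (b , p , refl)) = record
    { on-α₀    = λ q → ≅-sym (Yₐ-τ p q)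
    ; on-image = λ _ q e → ≡⇒≅ (cong dual (Yₐ-cong p q (τ-injective (sym e)))) }

  S : α → Quandle₁ Y
  S a = choose a (cover a)

  S-prescribed : ∀ a → Prescribed a (S a)
  S-prescribed a = choose-prescribed a (cover a)

  kei : Kei α τ Y
  kei = record
    { quandle = fromComponents S (Quandle.nonempty QY)
    ; law-v   = λ a → act-cancel (pair a)
    ; law-vi  = λ a → op-cancel (pair a) }
    where
    pair : ∀ a → KeiPair (S a) (S (τ a))
    pair a = prescribed-KeiPair (S-prescribed a) (S-prescribed (τ a))

  kei-restricts : RestrictsTo kei QY
  kei-restricts = (λ a p → act-≡ (on-α₀ (S-prescribed a) p))
                , (λ a p → op-≡ (on-α₀ (S-prescribed a) p))

  restriction-prescribed : (X : Kei α τ Y) → RestrictsTo X QY →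
                           ∀ a → Prescribed a (component (Kei.quandle X) a)
  restriction-prescribed X (act-agrees , op-agrees) a = record
    { on-α₀    = agrees-on-α₀
    ; on-image = λ { b p refl →
        KeiPair-unique (KeiPair-resp-≅ (≅-sym (agrees-on-α₀ p)) ≅-refl (component-KeiPair X b))
                       (KeiPair-dualʳ (Yₐ b p)) } }
    where
    agrees-on-α₀ : ∀ {b} (p : α₀ b) → component (Kei.quandle X) b ≅ Yₐ b p
    agrees-on-α₀ {b} p = act-agrees b p ,≅ op-agrees b p

  kei-unique : (X : Kei α τ Y) → RestrictsTo X QY → SameKei kei X
  kei-unique X r = (λ a → act-≡ (same a)) , (λ a → op-≡ (same a))
    where
    same : ∀ a → S a ≅ component (Kei.quandle X) a
    same a = prescribed-unique (S-prescribed a) (restriction-prescribed X r a)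

lemma14p1 : (α : Set) (τ : α → α) (τ-invol : ∀ a → τ (τ a) ≡ a)
    (α₀ : Pred α 0ℓ) (α₀-prop : Irrelevant α₀)
    (cover : ∀ a → α₀ a ⊎ Image τ α₀ a)
    (Y : Set) (QY : SubQuandle α₀ Y) → Compatible τ α₀ QY →
    Σ (Kei α τ Y) (λ X → RestrictsTo X QY ×
      (∀ (X' : Kei α τ Y) → RestrictsTo X' QY → SameKei X X'))
lemma14p1 α τ τ-invol α₀ α₀-prop cover Y QY compatible =
  kei , kei-restricts , kei-unique
  where open Extension α τ τ-invol α₀ α₀-prop cover QY compatible
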